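{- Let $m\ge 4$ and $n\ge 4$ be even integers and $h=\mathrm{lcm}(m,n)$. Suppose $\mathrm{HWP}^{*}(h; m^{r'}, n^{s'})$ has a solution for all nonnegative integers $r',s'$ with $r'+s'=h-1$. Then $\mathrm{HWP}^{*}(hx; m^{r}, n^{s})$ has a solution for all nonnegative integers $r,s,x$ with $r+s=hx-1$.
   Context: $K_v^*$ denotes the complete symmetric digraph of order $v$: $v$ vertices and, for every pair of distinct vertices $x,y$, both arcs $(x,y)$ and $(y,x)$. A directed $C_k$-factor of a digraph $D$ is a spanning subdigraph of $D$ that is a vertex-disjoint union of directed $k$-cycles. $\mathrm{HWP}^{*}(v; m^{r}, n^{s})$ is said to have a solution if the arc set of $K_v^*$ can be partitioned into $r$ directed $C_m$-factors and $s$ directed $C_n$-factors. -}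

module Defs where

open import Data.Nat using (ℕ; zero; suc; _+_; _*_; _<_; _≤_)
open import Data.Fin using (Fin; toℕ)
open import Data.Product using (Σ; ∃; _×_; _,_)
open import Relation.Binary.PropositionalEquality using (_≡_; _≢_)
open import Data.Sum using (_⊎_)
open import Data.Empty using (⊥)

iter : ∀ {A : Set} → ℕ → (A → A) → A → A
iter zero    f a = a
iter (suc k) f a = f (iter k f a)

-- A directed C_k-factor of K_v^* on vertex set Fin v, given by its
-- successor map σ: the factor has arc set {(x , σ x)}.  It is a
-- vertex-disjoint union of directed k-cycles spanning all vertices iff
-- σ is a bijection all of whose orbits have size exactly k.
record DirectedCycleFactor (v k : ℕ) : Set where
  field
    succ      : Fin v → Fin v
    bijective : Σ (Fin v → Fin v) (λ τ →
                  (∀ x → τ (succ x) ≡ x) × (∀ x → succ (τ x) ≡ x))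
    closes    : ∀ x → iter k succ x ≡ x
    minimal   : ∀ x j → 1 ≤ j → j < k → iter j succ x ≢ x
open DirectedCycleFactor public

-- HWP*(v; m^r, n^s): the arcs of K_v^* are partitioned into r directed
-- C_m-factors and s directed C_n-factors.  Every arc (x , y), x ≢ y, lies in
-- exactly one of the factors, and no factor contains a loop (an arc outside
-- K_v^*).
HWP* : (v m r n s : ℕ) → Set
HWP* v m r n s =
  Σ (Fin r → DirectedCycleFactor v m) λ F →
  Σ (Fin s → DirectedCycleFactor v n) λ G →
    ((∀ i x → succ (F i) x ≢ x) × (∀ j x → succ (G j) x ≢ x)) ×
    (∀ x y → x ≢ y → ExactlyOne F G x y)
  where
  ExactlyOne : (Fin r → DirectedCycleFactor v m) →
               (Fin s → DirectedCycleFactor v n) → Fin v → Fin v → Set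
  ExactlyOne F G x y =
    ((Σ (Fin r) λ i → succ (F i) x ≡ y) ⊎ (Σ (Fin s) λ j → succ (G j) x ≡ y)) ×
    (∀ i i′ → succ (F i) x ≡ y → succ (F i′) x ≡ y → i ≡ i′) ×
    (∀ j j′ → succ (G j) x ≡ y → succ (G j′) x ≡ y → j ≡ j′) ×
    (∀ i j → succ (F i) x ≡ y → succ (G j) x ≡ y → ⊥)

-- Write h = 2q and x = y + 1, and take ℤ_q × B as vertex set, where B = ℤ_{2y+1} ∪ {∞}.
-- The matchings τ_d (∞ ↔ d, i ↔ 2d − i) form a one-factorisation of the complete graph on B.
-- τ_0 pairs the blocks into x layers of h vertices, and each layer carries a copy of a
-- solution of HWP*(h; m^{r₀}, n^{s₀}) with r₀ + s₀ = h − 1.  Every other matching τ_d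
-- together with an element e ∈ ℤ_q of order μ gives q factors (z, B) ↦ (z + k or z + e − k, τ_d B),
-- whose cycles have length 2μ and which partition the arcs between the blocks matched by τ_d.
-- Giving α of the 2y matchings to m = 2μ and β = 2y − α to n = 2ν produces r = r₀ + αq
-- and s = s₀ + βq, and every r + s = hx − 1 splits in this way.

module Submission where

open import Defs
open import Level using (0ℓ)
open import Algebra.Bundles using (AbelianGroup)
open import Algebra.Core using (Op₁; Op₂)
open import Algebra.Structures using (IsAbelianGroup)
open import Data.Bool using (Bool; true; false; not; T)
open import Data.Bool.Properties using (T-irrelevant; T-≡)
open import Data.Empty using (⊥-elim)
open import Data.Fin using (Fin; toℕ; fromℕ<; splitAt; join) renaming (zero to fzero; suc to fsuc)
open import Data.Fin.Properties
  using (_≟_; toℕ-injective; toℕ-fromℕ<; toℕ<n; splitAt-join; join-splitAt; +↔⊎; *↔×; 2↔Bool)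
open import Data.Maybe using (Maybe; just; nothing)
open import Data.Maybe.Properties using (just-injective) renaming (≡-dec to Maybe-≡-dec)
open import Data.Nat
  using (ℕ; zero; suc; _+_; _*_; _∸_; _≤_; _<_; _<?_; _≤?_; z≤n; s≤s; s≤s⁻¹; NonZero; >-nonZero; >-nonZero⁻¹; ≢-nonZero⁻¹)
open import Data.Nat.Properties
  using ( +-assoc; +-comm; +-identityʳ; +-suc; +-cancelˡ-≡; *-comm; *-assoc; *-zeroʳ; suc-injective
        ; m∸n+n≡m; m+[n∸m]≡n; <⇒≤; <⇒≢; <-irrefl; <-cmp; ≤-trans; ≮⇒≥; ≰⇒>; m≤m+n; m≤n⇒m≤1+n; m≤m*n; n≢0⇒n>0
        ; +-mono-≤-<; +-monoʳ-≤; *-mono-≤; *-monoˡ-<; *-cancelʳ-<; +-commutativeSemigroup; module ≤-Reasoning)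
open import Data.Nat.DivMod using (_%_; m%n<n; m<n⇒m%n≡m; n%n≡0; %-distribˡ-+; [m+kn]%n≡m%n)
open import Data.Nat.Divisibility using (_∣_; divides; *-cancelʳ-∣)
open import Data.Nat.LCM using (lcm; m∣lcm[m,n]; n∣lcm[m,n])
open import Data.Nat.Tactic.RingSolver using (solve-∀)
open import Algebra.Properties.CommutativeSemigroup +-commutativeSemigroup
  using () renaming (x∙yz≈y∙xz to x+[y+z]≡y+[x+z])
open import Data.Product using (Σ; ∃; _×_; _,_; proj₁; proj₂; map₂)
open import Data.Product.Function.NonDependent.Propositional using (_×-↔_)
open import Data.Sum using (_⊎_; inj₁; inj₂; [_,_]′)
open import Data.Sum.Properties using (inj₁-injective; inj₂-injective)
open import Data.Sum.Function.Propositional using (_⊎-↔_)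
open import Function using (_∘_; Equivalence)
open import Function.Bundles using (_↔_; Inverse; mk↔ₛ′)
open import Function.Properties.Inverse using (↔-refl; ↔-sym; ↔-trans)
open import Relation.Binary.Definitions using (DecidableEquality; tri<; tri≈; tri>)
open import Relation.Binary.PropositionalEquality
open import Relation.Nullary using (¬_; Dec; yes; no; does; contradiction)
open import Relation.Nullary.Decidable using (dec-true; dec-false; map′)

open Inverse using (to; from; strictlyInverseˡ; strictlyInverseʳ)

module _ {A B : Set} (φ : A ↔ B) where

  to-injective : ∀ {a a′} → to φ a ≡ to φ a′ → a ≡ a′
  to-injective {a} {a′} e = trans (sym (strictlyInverseʳ φ a)) (trans (cong (from φ) e) (strictlyInverseʳ φ a′))

  from-injective : ∀ {b b′} → from φ b ≡ from φ b′ → b ≡ b′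
  from-injective {b} {b′} e = trans (sym (strictlyInverseˡ φ b)) (trans (cong (to φ) e) (strictlyInverseˡ φ b′))

  to⇒from : ∀ {a b} → to φ a ≡ b → a ≡ from φ b
  to⇒from {a} e = trans (sym (strictlyInverseʳ φ a)) (cong (from φ) e)

  iter-conjugate : ∀ (f : A → A) j b → iter j (to φ ∘ f ∘ from φ) b ≡ to φ (iter j f (from φ b))
  iter-conjugate f zero    b = sym (strictlyInverseˡ φ b)
  iter-conjugate f (suc j) b =
    cong (to φ ∘ f) (trans (cong (from φ) (iter-conjugate f j b)) (strictlyInverseʳ φ _))

record CycleFactor (V : Set) (k : ℕ) : Set where
  field
    next           : V → V
    prev           : V → V
    prev-next      : ∀ v → prev (next v) ≡ v
    next-prev      : ∀ v → next (prev v) ≡ v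
    next-period    : ∀ v → iter k next v ≡ v
    next-aperiodic : ∀ v j → 1 ≤ j → j < k → iter j next v ≢ v
open CycleFactor

mapFactor : ∀ {A B : Set} {k} → A ↔ B → CycleFactor A k → CycleFactor B k
mapFactor {k = k} φ F = record
  { next           = to φ ∘ next F ∘ from φ
  ; prev           = to φ ∘ prev F ∘ from φ
  ; prev-next      = λ b → trans (cong (to φ ∘ prev F) (strictlyInverseʳ φ _))
                             (trans (cong (to φ) (prev-next F _)) (strictlyInverseˡ φ b))
  ; next-prev      = λ b → trans (cong (to φ ∘ next F) (strictlyInverseʳ φ _))
                             (trans (cong (to φ) (next-prev F _)) (strictlyInverseˡ φ b))
  ; next-period    = λ b → trans (iter-conjugate φ (next F) k b)
                             (trans (cong (to φ) (next-period F _)) (strictlyInverseˡ φ b))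
  ; next-aperiodic = λ b j 1≤j j<k e → next-aperiodic F (from φ b) j 1≤j j<k
                       (to⇒from φ (trans (sym (iter-conjugate φ (next F) j b)) e))
  }

record Packing (V I J : Set) (m n : ℕ) (Arc : V → V → Set) : Set where
  field
    mFactor  : I → CycleFactor V m
    nFactor  : J → CycleFactor V n
    mArc     : ∀ i v → Arc v (next (mFactor i) v)
    nArc     : ∀ j v → Arc v (next (nFactor j) v)
    cover    : ∀ a b → Arc a b →
               (∃ λ i → next (mFactor i) a ≡ b) ⊎ (∃ λ j → next (nFactor j) a ≡ b)
    mUnique  : ∀ a i i′ → next (mFactor i) a ≡ next (mFactor i′) a → i ≡ i′
    nUnique  : ∀ a j j′ → next (nFactor j) a ≡ next (nFactor j′) a → j ≡ j′
    disjoint : ∀ a i j → next (mFactor i) a ≢ next (nFactor j) a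
open Packing

Decomposition : (V I J : Set) (m n : ℕ) → Set
Decomposition V I J m n = Packing V I J m n _≢_

decomposition⇒HWP* : ∀ {v m r n s} → Decomposition (Fin v) (Fin r) (Fin s) m n → HWP* v m r n s
decomposition⇒HWP* D =
  (λ i → toDCF (mFactor D i)) , (λ j → toDCF (nFactor D j)) ,
  ((λ i x → ≢-sym (mArc D i x)) , (λ j x → ≢-sym (nArc D j x))) ,
  λ a b a≢b → cover D a b a≢b ,
              (λ i i′ e e′ → mUnique D a i i′ (trans e (sym e′))) ,
              (λ j j′ e e′ → nUnique D a j j′ (trans e (sym e′))) ,
              (λ i j e e′ → disjoint D a i j (trans e (sym e′)))
  where
  toDCF : ∀ {v k} → CycleFactor (Fin v) k → DirectedCycleFactor v k
  toDCF F = record { succ = next F ; bijective = prev F , prev-next F , next-prev F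
                   ; closes = next-period F ; minimal = next-aperiodic F }

HWP*⇒decomposition : ∀ {v m r n s} → HWP* v m r n s → Decomposition (Fin v) (Fin r) (Fin s) m n
HWP*⇒decomposition (F , G , (F-loopless , G-loopless) , exactlyOne) = record
  { mFactor  = fromDCF ∘ F
  ; nFactor  = fromDCF ∘ G
  ; mArc     = λ i a → ≢-sym (F-loopless i a)
  ; nArc     = λ j a → ≢-sym (G-loopless j a)
  ; cover    = λ a b a≢b → proj₁ (exactlyOne a b a≢b)
  ; mUnique  = λ a i i′ e → proj₁ (proj₂ (exactlyOne a _ (≢-sym (F-loopless i a)))) i i′ refl (sym e)
  ; nUnique  = λ a j j′ e → proj₁ (proj₂ (proj₂ (exactlyOne a _ (≢-sym (G-loopless j a))))) j j′ refl (sym e)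
  ; disjoint = λ a i j e → proj₂ (proj₂ (proj₂ (exactlyOne a _ (≢-sym (F-loopless i a))))) i j refl (sym e)
  }
  where
  fromDCF : ∀ {v k} → DirectedCycleFactor v k → CycleFactor (Fin v) k
  fromDCF F = record { next = succ F ; prev = proj₁ (bijective F)
                     ; prev-next = proj₁ (proj₂ (bijective F)) ; next-prev = proj₂ (proj₂ (bijective F))
                     ; next-period = closes F ; next-aperiodic = minimal F }

mapPacking : ∀ {V V′ I I′ J J′ m n} {Arc : V → V → Set} {Arc′ : V′ → V′ → Set} (φ : V ↔ V′) →
             (∀ {a b} → Arc a b → Arc′ (to φ a) (to φ b)) →
             (∀ {a b} → Arc′ a b → Arc (from φ a) (from φ b)) →
             I ↔ I′ → J ↔ J′ → Packing V I J m n Arc → Packing V′ I′ J′ m n Arc′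
mapPacking {V} {V′} {I} {I′} {J} {J′} {m} {n} {Arc} {Arc′} φ arc⇒ arc⇐ ι κ D = record
  { mFactor  = mFactor′
  ; nFactor  = nFactor′
  ; mArc     = λ i a → moveArc (mArc D _ (from φ a))
  ; nArc     = λ j a → moveArc (nArc D _ (from φ a))
  ; cover    = cover′
  ; mUnique  = λ a i i′ e → from-injective ι (mUnique D (from φ a) _ _ (to-injective φ e))
  ; nUnique  = λ a j j′ e → from-injective κ (nUnique D (from φ a) _ _ (to-injective φ e))
  ; disjoint = λ a i j e → disjoint D (from φ a) _ _ (to-injective φ e)
  }
  where
  mFactor′ : I′ → CycleFactor V′ m
  mFactor′ = mapFactor φ ∘ mFactor D ∘ from ι
  nFactor′ : J′ → CycleFactor V′ n
  nFactor′ = mapFactor φ ∘ nFactor D ∘ from κ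
  moveArc : ∀ {a b} → Arc (from φ a) b → Arc′ a (to φ b)
  moveArc {a} r = subst (λ x → Arc′ x _) (strictlyInverseˡ φ a) (arc⇒ r)
  moved : ∀ {K K′ k} (ψ : K ↔ K′) (F : K → CycleFactor V k) {a b} i →
          next (F i) (from φ a) ≡ from φ b → to φ (next (F (from ψ (to ψ i))) (from φ a)) ≡ b
  moved ψ F i e = trans (cong (λ i → to φ (next (F i) _)) (strictlyInverseʳ ψ i))
                        (trans (cong (to φ) e) (strictlyInverseˡ φ _))
  cover′ : ∀ a b → Arc′ a b → (∃ λ i → next (mFactor′ i) a ≡ b) ⊎ (∃ λ j → next (nFactor′ j) a ≡ b)
  cover′ a b r with cover D (from φ a) (from φ b) (arc⇐ r)
  ... | inj₁ (i , e) = inj₁ (to ι i , moved ι (mFactor D) i e)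
  ... | inj₂ (j , e) = inj₂ (to κ j , moved κ (nFactor D) j e)

mapDecomposition : ∀ {V V′ I I′ J J′ m n} → V ↔ V′ → I ↔ I′ → J ↔ J′ →
                   Decomposition V I J m n → Decomposition V′ I′ J′ m n
mapDecomposition φ = mapPacking φ (λ a≢b → a≢b ∘ to-injective φ) (λ a≢b → a≢b ∘ from-injective φ)

glue : ∀ {V I I′ J J′ m n} (R : V → V → Set) → (∀ a b → Dec (R a b)) → (∀ a → R a a) →
       Packing V I J m n (λ a b → a ≢ b × R a b) →
       Packing V I′ J′ m n (λ a b → ¬ R a b) →
       Decomposition V (I ⊎ I′) (J ⊎ J′) m n
glue {V} {I} {I′} {J} {J′} {m} {n} R R? R-refl P Q = record
  { mFactor  = mFactor′
  ; nFactor  = nFactor′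
  ; mArc     = λ { (inj₁ i) v → proj₁ (mArc P i v) ; (inj₂ i) v → distinct (mArc Q i v) }
  ; nArc     = λ { (inj₁ j) v → proj₁ (nArc P j v) ; (inj₂ j) v → distinct (nArc Q j v) }
  ; cover    = cover′
  ; mUnique  = mUnique′
  ; nUnique  = nUnique′
  ; disjoint = disjoint′
  }
  where
  mFactor′ : I ⊎ I′ → CycleFactor V m
  mFactor′ (inj₁ i) = mFactor P i
  mFactor′ (inj₂ i) = mFactor Q i
  nFactor′ : J ⊎ J′ → CycleFactor V n
  nFactor′ (inj₁ j) = nFactor P j
  nFactor′ (inj₂ j) = nFactor Q j
  distinct : ∀ {a b} → ¬ R a b → a ≢ b
  distinct ¬r refl = ¬r (R-refl _)
  separated : ∀ {a b c} → b ≡ c → R a b → ¬ R a c → ∀ {A : Set} → A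
  separated refl r ¬r = ⊥-elim (¬r r)
  cover′ : ∀ a b → a ≢ b → (∃ λ i → next (mFactor′ i) a ≡ b) ⊎ (∃ λ j → next (nFactor′ j) a ≡ b)
  cover′ a b a≢b with R? a b
  ... | yes r with cover P a b (a≢b , r)
  ...   | inj₁ (i , e) = inj₁ (inj₁ i , e)
  ...   | inj₂ (j , e) = inj₂ (inj₁ j , e)
  cover′ a b a≢b | no ¬r with cover Q a b ¬r
  ...   | inj₁ (i , e) = inj₁ (inj₂ i , e)
  ...   | inj₂ (j , e) = inj₂ (inj₂ j , e)
  mUnique′ : ∀ a i i′ → next (mFactor′ i) a ≡ next (mFactor′ i′) a → i ≡ i′
  mUnique′ a (inj₁ i) (inj₁ i′) e = cong inj₁ (mUnique P a i i′ e)
  mUnique′ a (inj₁ i) (inj₂ i′) e = separated e (proj₂ (mArc P i a)) (mArc Q i′ a)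
  mUnique′ a (inj₂ i) (inj₁ i′) e = separated (sym e) (proj₂ (mArc P i′ a)) (mArc Q i a)
  mUnique′ a (inj₂ i) (inj₂ i′) e = cong inj₂ (mUnique Q a i i′ e)
  nUnique′ : ∀ a j j′ → next (nFactor′ j) a ≡ next (nFactor′ j′) a → j ≡ j′
  nUnique′ a (inj₁ j) (inj₁ j′) e = cong inj₁ (nUnique P a j j′ e)
  nUnique′ a (inj₁ j) (inj₂ j′) e = separated e (proj₂ (nArc P j a)) (nArc Q j′ a)
  nUnique′ a (inj₂ j) (inj₁ j′) e = separated (sym e) (proj₂ (nArc P j′ a)) (nArc Q j a)
  nUnique′ a (inj₂ j) (inj₂ j′) e = cong inj₂ (nUnique Q a j j′ e)
  disjoint′ : ∀ a i j → next (mFactor′ i) a ≢ next (nFactor′ j) a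
  disjoint′ a (inj₁ i) (inj₁ j) e = disjoint P a i j e
  disjoint′ a (inj₁ i) (inj₂ j) e = separated e (proj₂ (mArc P i a)) (nArc Q j a)
  disjoint′ a (inj₂ i) (inj₁ j) e = separated (sym e) (proj₂ (nArc P j a)) (mArc Q i a)
  disjoint′ a (inj₂ i) (inj₂ j) e = disjoint Q a i j e

module _ {L P : Set} where

  iter-map₂ : ∀ (f : P → P) j l p → iter j (map₂ {A = L} f) (l , p) ≡ (l , iter j f p)
  iter-map₂ f zero    l p = refl
  iter-map₂ f (suc j) l p = cong (map₂ f) (iter-map₂ f j l p)

  layerFactor : ∀ {k} → CycleFactor P k → CycleFactor (L × P) k
  layerFactor {k} F = record
    { next           = map₂ (next F)
    ; prev           = map₂ (prev F)
    ; prev-next      = λ (l , p) → cong (l ,_) (prev-next F p)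
    ; next-prev      = λ (l , p) → cong (l ,_) (next-prev F p)
    ; next-period    = λ (l , p) → trans (iter-map₂ (next F) k l p) (cong (l ,_) (next-period F p))
    ; next-aperiodic = λ (l , p) j 1≤j j<k e →
        next-aperiodic F p j 1≤j j<k (cong proj₂ (trans (sym (iter-map₂ (next F) j l p)) e))
    }

  layerPacking : ∀ {I J m n} → Decomposition P I J m n →
                 Packing (L × P) I J m n (λ a b → a ≢ b × proj₁ a ≡ proj₁ b)
  layerPacking D = record
    { mFactor  = layerFactor ∘ mFactor D
    ; nFactor  = layerFactor ∘ nFactor D
    ; mArc     = λ i (l , p) → (λ e → mArc D i p (cong proj₂ e)) , refl
    ; nArc     = λ j (l , p) → (λ e → nArc D j p (cong proj₂ e)) , refl
    ; cover    = λ { (l , p) (.l , p′) (a≢b , refl) →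
                   inLayer {F = mFactor D} {G = nFactor D} l (cover D p p′ (a≢b ∘ cong (l ,_))) }
    ; mUnique  = λ a i i′ e → mUnique D (proj₂ a) i i′ (cong proj₂ e)
    ; nUnique  = λ a j j′ e → nUnique D (proj₂ a) j j′ (cong proj₂ e)
    ; disjoint = λ a i j e → disjoint D (proj₂ a) i j (cong proj₂ e)
    }
    where
    inLayer : ∀ {I J m n} {F : I → CycleFactor P m} {G : J → CycleFactor P n} {p p′} l →
           (∃ λ i → next (F i) p ≡ p′) ⊎ (∃ λ j → next (G j) p ≡ p′) →
           (∃ λ i → next (layerFactor (F i)) (l , p) ≡ (l , p′)) ⊎
           (∃ λ j → next (layerFactor (G j)) (l , p) ≡ (l , p′))
    inLayer l (inj₁ (i , e)) = inj₁ (i , cong (l ,_) e)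
    inLayer l (inj₂ (j , e)) = inj₂ (j , cong (l ,_) e)

module InvolutionSplit {X : Set} (σ : X → X) (σ-involutive : ∀ x → σ (σ x) ≡ x)
                       (side : X → Bool) (side-σ : ∀ x → side (σ x) ≡ not (side x)) where

  Rep : Set
  Rep = Σ X (T ∘ side)

  Rep-≡ : ∀ {r r′ : Rep} → proj₁ r ≡ proj₁ r′ → r ≡ r′
  Rep-≡ {x , t} {.x , t′} refl = cong (x ,_) (T-irrelevant t t′)

  orient : Bool → X → X
  orient true  x = x
  orient false x = σ x

  orient-involutive : ∀ b x → orient b (orient b x) ≡ x
  orient-involutive true  x = refl
  orient-involutive false x = σ-involutive x

  side-orient : ∀ b x → side x ≡ b → T (side (orient b x))
  side-orient true  x e = Equivalence.from T-≡ e
  side-orient false x e = Equivalence.from T-≡ (trans (side-σ x) (cong not e))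

  rep : X → Rep
  rep x = orient (side x) x , side-orient (side x) x refl

  split : X ↔ (Rep × Bool)
  split = mk↔ₛ′ (λ x → rep x , side x) (λ (r , b) → orient b (proj₁ r))
                to-from (λ x → orient-involutive (side x) x)
    where
    side-back : ∀ b x → T (side x) → side (orient b x) ≡ b
    side-back true  x t = Equivalence.to T-≡ t
    side-back false x t = trans (side-σ x) (cong not (Equivalence.to T-≡ t))
    to-from : ∀ ((r , b) : Rep × Bool) → (rep (orient b (proj₁ r)) , side (orient b (proj₁ r))) ≡ (r , b)
    to-from ((x , t) , b) = cong₂ _,_
      (Rep-≡ (trans (cong (λ c → orient c (orient b x)) (side-back b x t)) (orient-involutive b x)))
      (side-back b x t)

  rep-σ : ∀ x → rep (σ x) ≡ rep x
  rep-σ x = Rep-≡ (trans (cong (λ c → orient c (σ x)) (side-σ x)) (orient-not (side x)))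
    where
    orient-not : ∀ b → orient (not b) (σ x) ≡ orient b x
    orient-not true  = σ-involutive x
    orient-not false = refl

  rep≡⇒ : ∀ {x x′} → rep x ≡ rep x′ → x′ ≡ x ⊎ x′ ≡ σ x
  rep≡⇒ {x} {x′} e = orbit (side x) (side x′) (begin
    x′                                   ≡⟨ orient-involutive (side x′) x′ ⟨
    orient (side x′) (orient (side x′) x′) ≡⟨ cong (orient (side x′) ∘ proj₁) e ⟨
    orient (side x′) (orient (side x) x)   ∎)
    where
    open ≡-Reasoning
    orbit : ∀ b b′ → x′ ≡ orient b′ (orient b x) → x′ ≡ x ⊎ x′ ≡ σ x
    orbit true  true  e = inj₁ e
    orbit true  false e = inj₂ e
    orbit false true  e = inj₂ e
    orbit false false e = inj₁ (trans e (σ-involutive x))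

module Orientation {X : Set} (code : X → ℕ)
                   (code-injective : ∀ {x x′} → code x ≡ code x′ → x ≡ x′) where

  side : (X → X) → X → Bool
  side σ x = does (code x <? code (σ x))

  side-flip : ∀ σ x → σ (σ x) ≡ x → σ x ≢ x → side σ (σ x) ≡ not (side σ x)
  side-flip σ x σσx≡x σx≢x rewrite σσx≡x with <-cmp (code x) (code (σ x))
  ... | tri< lt _ ¬gt = trans (dec-false (_ <? _) ¬gt) (cong not (sym (dec-true (_ <? _) lt)))
  ... | tri≈ _ eq _   = ⊥-elim (σx≢x (code-injective (sym eq)))
  ... | tri> ¬lt _ gt = trans (dec-true (_ <? _) gt) (cong not (sym (dec-false (_ <? _) ¬lt)))

module AbelianGroupFacts {G : Set} {_⊕_ : Op₂ G} {0̂ : G} {⊖_ : Op₁ G}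
                         (isAbelianGroup : IsAbelianGroup _≡_ _⊕_ 0̂ ⊖_) where

  abelianGroup : AbelianGroup 0ℓ 0ℓ
  abelianGroup = record { isAbelianGroup = isAbelianGroup }

  open IsAbelianGroup isAbelianGroup public using (_-_; assoc; comm; identityʳ)
  open import Algebra.Properties.Group (AbelianGroup.group abelianGroup) public
    using (∙-cancelˡ; ∙-cancelʳ; //-rightDividesˡ; //-rightDividesʳ)

  x+[y-x]≡y : ∀ x y → x ⊕ (y - x) ≡ y
  x+[y-x]≡y x y = trans (comm x (y - x)) (//-rightDividesˡ x y)

  [x+y]-x≡y : ∀ x y → (x ⊕ y) - x ≡ y
  [x+y]-x≡y x y = trans (cong (_- x) (comm x y)) (//-rightDividesʳ x y)

  x-y≡z⇒y≡x-z : ∀ {x y z} → x - y ≡ z → y ≡ x - z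
  x-y≡z⇒y≡x-z {x} {y} refl = ∙-cancelˡ (x - y) _ _ (trans (//-rightDividesˡ y x) (sym (x+[y-x]≡y (x - y) x)))

  x-[x-y]≡y : ∀ x y → x - (x - y) ≡ y
  x-[x-y]≡y x y = sym (x-y≡z⇒y≡x-z refl)

  x-y≡z⇒x≡z+y : ∀ {x y z} → x - y ≡ z → x ≡ z ⊕ y
  x-y≡z⇒x≡z+y {x} {y} refl = sym (//-rightDividesˡ y x)

  open import Algebra.Definitions.RawMonoid (AbelianGroup.rawMonoid abelianGroup) public
    using () renaming (_×_ to _·_)

  shift : G → G → Bool → G
  shift e k true  = k
  shift e k false = e - k

  shift-sum : ∀ e k b → shift e k b ⊕ shift e k (not b) ≡ e
  shift-sum e k true  = x+[y-x]≡y k e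
  shift-sum e k false = //-rightDividesˡ k e

  shift-solve : ∀ e b c → Σ G λ k → shift e k b ≡ c
  shift-solve e true  c = c , refl
  shift-solve e false c = e - c , x-[x-y]≡y e c

  shift-injective : ∀ e b {k k′} → shift e k b ≡ shift e k′ b → k ≡ k′
  shift-injective e true  eq = eq
  shift-injective e false eq = trans (x-y≡z⇒y≡x-z eq) (x-[x-y]≡y e _)

  record HasOrder (μ : ℕ) (e : G) : Set where
    field
      order-period  : μ · e ≡ 0̂
      order-minimal : ∀ i → 1 ≤ i → i < μ → i · e ≢ 0̂

-- Maybe G stands for G ∪ {∞}.
module OneFactorisation {G : Set} {_⊕_ : Op₂ G} {0̂ : G} {⊖_ : Op₁ G}
                        (isAbelianGroup : IsAbelianGroup _≡_ _⊕_ 0̂ ⊖_) (_≟_ : DecidableEquality G)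
                        (half : G → G) (half-double : ∀ x → half x ⊕ half x ≡ x)
                        (double-injective : ∀ {x y} → x ⊕ x ≡ y ⊕ y → x ≡ y) where
  open AbelianGroupFacts isAbelianGroup

  τ : G → Maybe G → Maybe G
  τ d nothing = just d
  τ d (just i) with i ≟ d
  ... | yes _ = nothing
  ... | no  _ = just ((d ⊕ d) - i)

  τ-centre : ∀ d → τ d (just d) ≡ nothing
  τ-centre d with d ≟ d
  ... | yes _   = refl
  ... | no  d≢d = ⊥-elim (d≢d refl)

  τ-reflect : ∀ d i → i ≢ d → τ d (just i) ≡ just ((d ⊕ d) - i)
  τ-reflect d i i≢d with i ≟ d
  ... | yes i≡d = ⊥-elim (i≢d i≡d)
  ... | no  _   = refl

  reflection-off-centre : ∀ d i → i ≢ d → (d ⊕ d) - i ≢ d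
  reflection-off-centre d i i≢d e = i≢d (trans (x-y≡z⇒y≡x-z e) ([x+y]-x≡y d d))

  τ-involutive : ∀ d B → τ d (τ d B) ≡ B
  τ-involutive d nothing = τ-centre d
  τ-involutive d (just i) with i ≟ d
  ... | yes refl = refl
  ... | no  i≢d  = trans (τ-reflect d _ (reflection-off-centre d i i≢d)) (cong just (x-[x-y]≡y (d ⊕ d) i))

  τ-fixpointFree : ∀ d B → τ d B ≢ B
  τ-fixpointFree d nothing ()
  τ-fixpointFree d (just i) with i ≟ d
  ... | yes _   = λ ()
  ... | no  i≢d = λ e → i≢d (sym (double-injective (x-y≡z⇒x≡z+y (just-injective e))))

  τ-injective : ∀ d d′ B → τ d B ≡ τ d′ B → d ≡ d′
  τ-injective d d′ nothing e = just-injective e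
  τ-injective d d′ (just i) with i ≟ d | i ≟ d′
  ... | yes i≡d | yes i≡d′ = λ _ → trans (sym i≡d) i≡d′
  ... | yes _   | no  _    = λ ()
  ... | no  _   | yes _    = λ ()
  ... | no  _   | no  _    = λ e → double-injective (∙-cancelʳ (⊖ i) _ _ (just-injective e))

  τ-connects : ∀ B B′ → B ≢ B′ → Σ G λ d → τ d B ≡ B′
  τ-connects nothing  nothing  B≢B′ = ⊥-elim (B≢B′ refl)
  τ-connects nothing  (just j) B≢B′ = j , refl
  τ-connects (just i) nothing  B≢B′ = i , τ-centre i
  τ-connects (just i) (just j) B≢B′ = d , trans (τ-reflect d i i≢d)
      (cong just (trans (cong (_- i) (half-double (i ⊕ j))) ([x+y]-x≡y i j)))
    where
    d : G
    d = half (i ⊕ j)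
    i≢d : i ≢ d
    i≢d i≡d = B≢B′ (cong just (∙-cancelˡ i i j (trans (cong (λ x → x ⊕ x) i≡d) (half-double (i ⊕ j)))))

even-or-odd : ∀ j → (Σ ℕ λ i → j ≡ i * 2) ⊎ (Σ ℕ λ i → j ≡ suc (i * 2))
even-or-odd zero = inj₁ (0 , refl)
even-or-odd (suc zero) = inj₂ (0 , refl)
even-or-odd (suc (suc j)) with even-or-odd j
... | inj₁ (i , refl) = inj₁ (suc i , refl)
... | inj₂ (i , refl) = inj₂ (suc i , refl)

-- Alternating between x and σ x while adding k or e - k to the G-coordinate, two
-- steps add e, so the cycles have length twice the order of e.
module BundleFactor {G : Set} {_⊕_ : Op₂ G} {0̂ : G} {⊖_ : Op₁ G}
                    (isAbelianGroup : IsAbelianGroup _≡_ _⊕_ 0̂ ⊖_)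
                    {X : Set} (σ : X → X)
                    (σ-involutive : ∀ x → σ (σ x) ≡ x) (σ-fixpointFree : ∀ x → σ x ≢ x)
                    (side : X → Bool) (side-σ : ∀ x → side (σ x) ≡ not (side x)) where
  open AbelianGroupFacts isAbelianGroup

  bundleStep : G → G → G × X → G × X
  bundleStep e k (z , x) = z ⊕ shift e k (side x) , σ x

  bundleFactor : ∀ {μ e} → HasOrder μ e → G → CycleFactor (G × X) (μ * 2)
  bundleFactor {μ} {e} order k = record
    { next           = step
    ; prev           = λ (z , x) → z - shift e k (side (σ x)) , σ x
    ; prev-next      = λ (z , x) → cong₂ _,_
        (trans (cong (λ y → (z ⊕ shift e k (side x)) - shift e k (side y)) (σ-involutive x)) (//-rightDividesʳ _ z))
        (σ-involutive x)
    ; next-prev      = λ (z , x) → cong₂ _,_ (//-rightDividesˡ _ z) (σ-involutive x)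
    ; next-period    = λ (z , x) → trans (iter-step μ z x)
                         (cong (_, x) (trans (cong (z ⊕_) order-period) (identityʳ z)))
    ; next-aperiodic = aperiodic
    }
    where
    open HasOrder order
    step : G × X → G × X
    step = bundleStep e k
    step² : ∀ z x → step (step (z , x)) ≡ (z ⊕ e , x)
    step² z x = cong₂ _,_
      (trans (assoc z _ _) (cong (z ⊕_)
        (trans (cong (λ b → shift e k (side x) ⊕ shift e k b) (side-σ x)) (shift-sum e k (side x)))))
      (σ-involutive x)
    iter-step : ∀ i z x → iter (i * 2) step (z , x) ≡ (z ⊕ (i · e) , x)
    iter-step zero    z x = cong (_, x) (sym (identityʳ z))
    iter-step (suc i) z x = trans (cong (step ∘ step) (iter-step i z x))
      (trans (step² _ x) (cong (_, x) (trans (assoc z _ e) (cong (z ⊕_) (comm _ e)))))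
    aperiodic : ∀ v j → 1 ≤ j → j < μ * 2 → iter j step v ≢ v
    aperiodic (z , x) j 1≤j j<2μ loop with even-or-odd j
    ... | inj₁ (zero , refl) = contradiction 1≤j λ ()
    ... | inj₁ (suc i , refl) = order-minimal (suc i) (s≤s z≤n) (*-cancelʳ-< 2 (suc i) μ j<2μ)
          (∙-cancelˡ z _ _ (trans (cong proj₁ (trans (sym (iter-step (suc i) z x)) loop)) (sym (identityʳ z))))
    ... | inj₂ (i , refl) =
          σ-fixpointFree x (trans (cong (proj₂ ∘ step) (sym (iter-step i z x))) (cong proj₂ loop))

module BundlePacking {G : Set} {_⊕_ : Op₂ G} {0̂ : G} {⊖_ : Op₁ G}
                     (isAbelianGroup : IsAbelianGroup _≡_ _⊕_ 0̂ ⊖_)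
                     {X A B : Set} (σ : A ⊎ B → X → X)
                     (σ-involutive : ∀ t x → σ t (σ t x) ≡ x) (σ-fixpointFree : ∀ t x → σ t x ≢ x)
                     (side : A ⊎ B → X → Bool) (side-σ : ∀ t x → side t (σ t x) ≡ not (side t x))
                     (S : X → X → Set) (S-σ : ∀ t x → S x (σ t x))
                     (σ-onto : ∀ x x′ → S x x′ → Σ (A ⊎ B) λ t → σ t x ≡ x′)
                     (σ-injective : ∀ t t′ x → σ t x ≡ σ t′ x → t ≡ t′) where
  open AbelianGroupFacts isAbelianGroup
  module Bundle (t : A ⊎ B) = BundleFactor isAbelianGroup (σ t) (σ-involutive t) (σ-fixpointFree t) (side t) (side-σ t)

  bundlePacking : ∀ {μ ν e f} → HasOrder μ e → HasOrder ν f →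
                  Packing (G × X) (A × G) (B × G) (μ * 2) (ν * 2) (λ a b → S (proj₂ a) (proj₂ b))
  bundlePacking {e = e} {f} e-order f-order = record
    { mFactor  = λ (a , k) → Bundle.bundleFactor (inj₁ a) e-order k
    ; nFactor  = λ (b , k) → Bundle.bundleFactor (inj₂ b) f-order k
    ; mArc     = λ (a , k) (z , x) → S-σ (inj₁ a) x
    ; nArc     = λ (b , k) (z , x) → S-σ (inj₂ b) x
    ; cover    = cover′
    ; mUnique  = λ { (z , x) (a , k) (a′ , k′) eq → unique inj₁-injective e z x a a′ k k′ eq }
    ; nUnique  = λ { (z , x) (b , k) (b′ , k′) eq → unique inj₂-injective f z x b b′ k k′ eq }
    ; disjoint = λ (z , x) (a , k) (b , k′) eq → inj₁≢inj₂ (σ-injective _ _ x (cong proj₂ eq))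
    }
    where
    inj₁≢inj₂ : ∀ {a b} → inj₁ {B = B} a ≢ inj₂ b
    inj₁≢inj₂ ()
    reach : ∀ t e z z′ x → Σ G λ k → Bundle.bundleStep t e k (z , x) ≡ (z′ , σ t x)
    reach t e z z′ x with shift-solve e (side t x) (z′ - z)
    ... | k , eq = k , cong (_, σ t x) (trans (cong (z ⊕_) eq) (x+[y-x]≡y z z′))
    unique : ∀ {C : Set} {ι : C → A ⊎ B} → (∀ {c c′} → ι c ≡ ι c′ → c ≡ c′) → ∀ e z x c c′ k k′ →
             Bundle.bundleStep (ι c) e k (z , x) ≡ Bundle.bundleStep (ι c′) e k′ (z , x) → (c , k) ≡ (c′ , k′)
    unique {ι = ι} ι-injective e z x c c′ k k′ eq
      with ι-injective (σ-injective (ι c) (ι c′) x (cong proj₂ eq))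
    ... | refl = cong (c ,_) (shift-injective e (side (ι c) x) (∙-cancelˡ z _ _ (cong proj₁ eq)))
    cover′ : ∀ v v′ → S (proj₂ v) (proj₂ v′) →
            (∃ λ i → next (Bundle.bundleFactor (inj₁ (proj₁ i)) e-order (proj₂ i)) v ≡ v′) ⊎
            (∃ λ j → next (Bundle.bundleFactor (inj₂ (proj₁ j)) f-order (proj₂ j)) v ≡ v′)
    cover′ (z , x) (z′ , x′) s with σ-onto x x′ s
    ... | inj₁ a , refl = inj₁ (let (k , eq) = reach (inj₁ a) e z z′ x in (a , k) , eq)
    ... | inj₂ b , refl = inj₂ (let (k , eq) = reach (inj₂ b) f z z′ x in (b , k) , eq)

module ℤMod (w : ℕ) ⦃ _ : NonZero w ⦄ where

  mk : ℕ → Fin w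
  mk a = fromℕ< (m%n<n a w)

  mk-cong : ∀ {a b} → a % w ≡ b % w → mk a ≡ mk b
  mk-cong {a} {b} e = toℕ-injective (trans (toℕ-fromℕ< _) (trans e (sym (toℕ-fromℕ< _))))

  mk-injective-below : ∀ {a b} → a < w → b < w → mk a ≡ mk b → a ≡ b
  mk-injective-below {a} {b} a<w b<w e = begin
    a             ≡⟨ m<n⇒m%n≡m a<w ⟨
    a % w         ≡⟨ toℕ-fromℕ< (m%n<n a w) ⟨
    toℕ (mk a)    ≡⟨ cong toℕ e ⟩
    toℕ (mk b)    ≡⟨ toℕ-fromℕ< (m%n<n b w) ⟩
    b % w         ≡⟨ m<n⇒m%n≡m b<w ⟩
    b             ∎
    where open ≡-Reasoning

  mk-toℕ : ∀ x → mk (toℕ x) ≡ x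
  mk-toℕ x = toℕ-injective (trans (toℕ-fromℕ< _) (m<n⇒m%n≡m (toℕ<n x)))

  infixl 6 _⊕_

  0̂ : Fin w
  0̂ = mk 0

  opaque
    _⊕_ : Fin w → Fin w → Fin w
    x ⊕ y = mk (toℕ x + toℕ y)

    ⊖_ : Fin w → Fin w
    ⊖ x = mk (w ∸ toℕ x)

    ⊕-def : ∀ x y → x ⊕ y ≡ mk (toℕ x + toℕ y)
    ⊕-def x y = refl

    ⊖-def : ∀ x → ⊖ x ≡ mk (w ∸ toℕ x)
    ⊖-def x = refl

  mk-⊕ : ∀ a b → mk a ⊕ mk b ≡ mk (a + b)
  mk-⊕ a b = trans (⊕-def (mk a) (mk b)) (mk-cong
    (trans (cong₂ (λ u v → (u + v) % w) (toℕ-fromℕ< (m%n<n a w)) (toℕ-fromℕ< (m%n<n b w)))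
           (sym (%-distribˡ-+ a b w))))

  mk-w : mk w ≡ 0̂
  mk-w = mk-cong (trans (n%n≡0 w) (sym (m<n⇒m%n≡m (>-nonZero⁻¹ w))))

  -- Every law is transported from ℕ along the surjective homomorphism mk.
  ⊕-lift : ∀ {a b : ℕ} → a ≡ b → ∀ {x y} → mk a ≡ x → mk b ≡ y → x ≡ y
  ⊕-lift refl refl refl = refl

  isAbelianGroup : IsAbelianGroup _≡_ _⊕_ 0̂ ⊖_
  isAbelianGroup = record
    { isGroup = record
      { isMonoid = record
        { isSemigroup = record
          { isMagma = record { isEquivalence = isEquivalence ; ∙-cong = cong₂ _⊕_ }
          ; assoc   = λ x y z → ⊕-lift (+-assoc (toℕ x) (toℕ y) (toℕ z))
                         (trans (sym (mk-⊕ _ (toℕ z))) (cong₂ _⊕_ (sym (⊕-def x y)) (mk-toℕ z)))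
                         (trans (sym (mk-⊕ (toℕ x) _)) (cong₂ _⊕_ (mk-toℕ x) (sym (⊕-def y z))))
          }
        ; identity = (λ x → ⊕-lift refl (trans (sym (mk-⊕ 0 (toℕ x))) (cong (0̂ ⊕_) (mk-toℕ x))) (mk-toℕ x))
                   , (λ x → ⊕-lift (+-identityʳ (toℕ x))
                               (trans (sym (mk-⊕ (toℕ x) 0)) (cong (_⊕ 0̂) (mk-toℕ x))) (mk-toℕ x))
        }
      ; inverse = (λ x → ⊕-lift (m∸n+n≡m (<⇒≤ (toℕ<n x)))
                          (trans (sym (mk-⊕ _ _)) (cong₂ _⊕_ (sym (⊖-def x)) (mk-toℕ x))) mk-w)
                , (λ x → ⊕-lift (m+[n∸m]≡n (<⇒≤ (toℕ<n x)))
                          (trans (sym (mk-⊕ _ _)) (cong₂ _⊕_ (mk-toℕ x) (sym (⊖-def x)))) mk-w)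
      ; ⁻¹-cong = cong ⊖_
      }
    ; comm = λ x y → trans (⊕-def x y) (trans (cong mk (+-comm (toℕ x) (toℕ y))) (sym (⊕-def y x)))
    }

  open AbelianGroupFacts isAbelianGroup public

  ·-mk : ∀ j u → j · mk u ≡ mk (j * u)
  ·-mk zero    u = refl
  ·-mk (suc j) u = trans (cong (mk u ⊕_) (·-mk j u)) (mk-⊕ u (j * u))

  mk-order : ∀ {μ u} → w ≡ u * μ → HasOrder μ (mk u)
  mk-order {μ} {u} w≡uμ = record
    { order-period  = trans (·-mk μ u) (trans (cong mk μu≡w) mk-w)
    ; order-minimal = λ i 1≤i i<μ iu≡0 → <⇒≢ (*-mono-≤ 1≤i 1≤u)
        (sym (mk-injective-below (subst (i * u <_) μu≡w (*-monoˡ-< u ⦃ >-nonZero 1≤u ⦄ i<μ)) (>-nonZero⁻¹ w)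
                                 (trans (sym (·-mk i u)) iu≡0)))
    }
    where
    μu≡w : μ * u ≡ w
    μu≡w = trans (*-comm μ u) (sym w≡uμ)
    1≤u : 1 ≤ u
    1≤u = n≢0⇒n>0 λ { refl → ≢-nonZero⁻¹ w (trans (sym μu≡w) (*-zeroʳ μ)) }

module ℤOdd (y : ℕ) where
  open ℤMod (suc (y + y)) public

  half : Fin (suc (y + y)) → Fin (suc (y + y))
  half x = suc y · x

  half-double : ∀ x → half x ⊕ half x ≡ x
  half-double x = begin
    half x ⊕ half x                   ≡⟨ cong (λ u → half u ⊕ half u) (mk-toℕ x) ⟨
    half (mk a) ⊕ half (mk a)         ≡⟨ cong₂ _⊕_ (·-mk (suc y) a) (·-mk (suc y) a) ⟩
    mk (suc y * a) ⊕ mk (suc y * a)   ≡⟨ mk-⊕ (suc y * a) (suc y * a) ⟩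
    mk (suc y * a + suc y * a)        ≡⟨ cong mk (twice-half y a) ⟩
    mk (a + a * suc (y + y))          ≡⟨ mk-cong {a + a * suc (y + y)} {a} ([m+kn]%n≡m%n a a (suc (y + y))) ⟩
    mk a                              ≡⟨ mk-toℕ x ⟩
    x                                 ∎
    where
    open ≡-Reasoning
    a : ℕ
    a = toℕ x
    twice-half : ∀ y a → suc y * a + suc y * a ≡ a + a * suc (y + y)
    twice-half = solve-∀

  double-injective : ∀ {x x′} → x ⊕ x ≡ x′ ⊕ x′ → x ≡ x′
  double-injective {x} {x′} e = begin
    x                  ≡⟨ half-double x ⟨
    half x ⊕ half x    ≡⟨ ×-distrib-+ x x (suc y) ⟨
    half (x ⊕ x)       ≡⟨ cong half e ⟩
    half (x′ ⊕ x′)     ≡⟨ ×-distrib-+ x′ x′ (suc y) ⟩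
    half x′ ⊕ half x′  ≡⟨ half-double x′ ⟩
    x′                 ∎
    where
    open ≡-Reasoning
    open import Algebra.Properties.CommutativeMonoid.Mult (AbelianGroup.commutativeMonoid abelianGroup)
      using (×-distrib-+)

spread : ∀ {X R B A : Set} → X ↔ (R × B) → (A × X) ↔ (R × (A × B))
spread ψ = mk↔ₛ′ (λ (a , x) → proj₁ (to ψ x) , a , proj₂ (to ψ x))
                 (λ (r , a , b) → a , from ψ (r , b))
                 (λ (r , a , b) → cong (λ p → proj₁ p , a , proj₂ p) (strictlyInverseˡ ψ (r , b)))
                 (λ (a , x) → cong (a ,_) (strictlyInverseʳ ψ x))

-- Fin (suc (α + β)) with 0 removed, split into its first α and last β elements.
nonzeroSplit : ∀ {α β n} → α + β ≡ n → Maybe (Fin α ⊎ Fin β) ↔ Fin (suc n)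
nonzeroSplit {α} {β} refl = mk↔ₛ′
  (λ { nothing → fzero ; (just t) → fsuc (join α β t) })
  (λ { fzero → nothing ; (fsuc i) → just (splitAt α i) })
  (λ { fzero → refl ; (fsuc i) → cong fsuc (join-splitAt α β i) })
  (λ { nothing → refl ; (just t) → cong just (splitAt-join α β t) })

nonzeroSplit-nothing : ∀ {α β n} (eq : α + β ≡ n) → to (nonzeroSplit {α} {β} eq) nothing ≡ fzero
nonzeroSplit-nothing refl = refl

module Construction (y q : ℕ) ⦃ _ : NonZero q ⦄ where
  module D = ℤOdd y
  module Q = ℤMod q
  open OneFactorisation D.isAbelianGroup _≟_ D.half D.half-double D.double-injective

  Block : Set
  Block = Maybe (Fin (suc (y + y)))

  code : Block → ℕ
  code nothing  = 0
  code (just i) = suc (toℕ i)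

  code-injective : ∀ {B B′} → code B ≡ code B′ → B ≡ B′
  code-injective {nothing} {nothing} _ = refl
  code-injective {just i}  {just j}  e = cong just (toℕ-injective (suc-injective e))

  open Orientation code code-injective

  τ-side : ∀ d B → side (τ d) (τ d B) ≡ not (side (τ d) B)
  τ-side d B = side-flip (τ d) B (τ-involutive d B) (τ-fixpointFree d B)

  open InvolutionSplit (τ D.0̂) (τ-involutive D.0̂) (side (τ D.0̂)) (τ-side D.0̂)

  Vertex : Set
  Vertex = Fin q × Block

  SameLayer : Vertex → Vertex → Set
  SameLayer a b = rep (proj₂ a) ≡ rep (proj₂ b)

  SameLayer? : ∀ a b → Dec (SameLayer a b)
  SameLayer? a b = map′ Rep-≡ (cong proj₁) (Maybe-≡-dec _≟_ (proj₁ (rep (proj₂ a))) (proj₁ (rep (proj₂ b))))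

  layerIso : Vertex ↔ (Rep × (Fin q × Bool))
  layerIso = spread split

  rep-from : ∀ r b → rep (from split (r , b)) ≡ r
  rep-from r b = cong proj₁ (strictlyInverseˡ split (r , b))

  layered : ∀ {I J m n} → Decomposition (Fin q × Bool) I J m n →
            Packing Vertex I J m n (λ a b → a ≢ b × SameLayer a b)
  layered {I} {J} {m} {n} =
    mapPacking {Arc = λ a b → a ≢ b × proj₁ a ≡ proj₁ b} {Arc′ = λ a b → a ≢ b × SameLayer a b}
      (↔-sym layerIso) arc⇒ arc⇐ ↔-refl ↔-refl ∘ layerPacking
    where
    arc⇒ : ∀ {a b} → a ≢ b × proj₁ a ≡ proj₁ b →
           from layerIso a ≢ from layerIso b × SameLayer (from layerIso a) (from layerIso b)
    arc⇒ {r , z , b} {.r , z′ , b′} (a≢b , refl) =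
      a≢b ∘ from-injective layerIso , trans (rep-from r b) (sym (rep-from r b′))
    arc⇐ : ∀ {a b} → a ≢ b × SameLayer a b →
           to layerIso a ≢ to layerIso b × proj₁ (to layerIso a) ≡ proj₁ (to layerIso b)
    arc⇐ (a≢b , same) = a≢b ∘ to-injective layerIso , same

  module _ {α β} (α+β : α + β ≡ y + y) where
    ι : Maybe (Fin α ⊎ Fin β) ↔ Fin (suc (y + y))
    ι = nonzeroSplit α+β

    diff : Fin α ⊎ Fin β → Fin (suc (y + y))
    diff t = to ι (just t)

    diff≢0 : ∀ t → diff t ≢ D.0̂
    diff≢0 t e with to-injective ι (trans e (sym (nonzeroSplit-nothing {α} {β} α+β)))
    ... | ()

    zero-or-diff : ∀ d → d ≡ D.0̂ ⊎ Σ (Fin α ⊎ Fin β) λ t → diff t ≡ d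
    zero-or-diff d with from ι d in eq
    ... | nothing = inj₁ (trans (sym (strictlyInverseˡ ι d))
                                (trans (cong (to ι) eq) (nonzeroSplit-nothing {α} {β} α+β)))
    ... | just t  = inj₂ (t , trans (cong (to ι) (sym eq)) (strictlyInverseˡ ι d))

    crosses : ∀ t B → ¬ rep B ≡ rep (τ (diff t) B)
    crosses t B same = [ τ-fixpointFree (diff t) B , diff≢0 t ∘ τ-injective (diff t) D.0̂ B ]′ (rep≡⇒ same)

    crossing-diff : ∀ B B′ → ¬ rep B ≡ rep B′ → Σ (Fin α ⊎ Fin β) λ t → τ (diff t) B ≡ B′
    crossing-diff B B′ ¬same = connection (τ-connects B B′ λ { refl → ¬same refl })
      where
      connection : Σ _ (λ d → τ d B ≡ B′) → Σ (Fin α ⊎ Fin β) λ t → τ (diff t) B ≡ B′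
      connection (d , τdB≡B′) =
        [ (λ d≡0 → ⊥-elim (¬same (trans (sym (rep-σ B)) (cong rep (trans (cong (λ d → τ d B) (sym d≡0)) τdB≡B′)))))
        , (λ (t , diff≡d) → t , trans (cong (λ d → τ d B) diff≡d) τdB≡B′)
        ]′ (zero-or-diff d)

    crossing : ∀ {μ ν e f} → Q.HasOrder μ e → Q.HasOrder ν f →
               Packing Vertex (Fin α × Fin q) (Fin β × Fin q) (μ * 2) (ν * 2) (λ a b → ¬ SameLayer a b)
    crossing = BundlePacking.bundlePacking Q.isAbelianGroup (τ ∘ diff) (τ-involutive ∘ diff) (τ-fixpointFree ∘ diff)
      (side ∘ τ ∘ diff) (τ-side ∘ diff) (λ B B′ → ¬ rep B ≡ rep B′) crosses crossing-diff
      (λ t t′ B e → just-injective (to-injective ι (τ-injective (diff t) (diff t′) B e)))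

  decomposition : ∀ {I J μ ν e f α β} → α + β ≡ y + y → Q.HasOrder μ e → Q.HasOrder ν f →
                  Decomposition (Fin q × Bool) I J (μ * 2) (ν * 2) →
                  Decomposition Vertex (I ⊎ (Fin α × Fin q)) (J ⊎ (Fin β × Fin q)) (μ * 2) (ν * 2)
  decomposition α+β e-order f-order D =
    glue SameLayer SameLayer? (λ _ → refl) (layered D) (crossing α+β e-order f-order)

record Split (q c N r s : ℕ) : Set where
  field
    α β r₀ s₀ : ℕ
    α+β≡N     : α + β ≡ N
    r≡        : r ≡ r₀ + α * q
    s≡        : s ≡ s₀ + β * q
    r₀+s₀≡c   : r₀ + s₀ ≡ c

module _ {q : ℕ} (c N : ℕ) where

  drop-from-r : ∀ {r s} → q ≤ r → r + s ≡ c + suc N * q → r ∸ q + s ≡ c + N * q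
  drop-from-r {r} {s} q≤r eq = +-cancelˡ-≡ q _ _ (begin
    q + (r ∸ q + s)   ≡⟨ +-assoc q (r ∸ q) s ⟨
    q + (r ∸ q) + s   ≡⟨ cong (_+ s) (m+[n∸m]≡n q≤r) ⟩
    r + s             ≡⟨ eq ⟩
    c + (q + N * q)   ≡⟨ x+[y+z]≡y+[x+z] c q (N * q) ⟩
    q + (c + N * q)   ∎)
    where open ≡-Reasoning

  drop-from-s : ∀ {r s} → q ≤ s → r + s ≡ c + suc N * q → r + (s ∸ q) ≡ c + N * q
  drop-from-s {r} {s} q≤s eq = +-cancelˡ-≡ q _ _ (begin
    q + (r + (s ∸ q))   ≡⟨ x+[y+z]≡y+[x+z] q r (s ∸ q) ⟩
    r + (q + (s ∸ q))   ≡⟨ cong (r +_) (m+[n∸m]≡n q≤s) ⟩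
    r + s               ≡⟨ eq ⟩
    c + (q + N * q)     ≡⟨ x+[y+z]≡y+[x+z] c q (N * q) ⟩
    q + (c + N * q)     ∎)
    where open ≡-Reasoning

  room-in-s : ∀ {r s} → q ≤ suc c → r < q → r + s ≡ c + suc N * q → q ≤ s
  room-in-s {r} {s} q≤1+c r<q eq = ≮⇒≥ λ s<q → <-irrefl eq (begin-strict
    r + s             <⟨ +-mono-≤-< (s≤s⁻¹ (≤-trans r<q q≤1+c)) s<q ⟩
    c + q             ≤⟨ +-monoʳ-≤ c (m≤m+n q (N * q)) ⟩
    c + (q + N * q)   ∎)
    where open ≤-Reasoning

split : ∀ q c → q ≤ suc c → ∀ N r s → r + s ≡ c + N * q → Split q c N r s
split q c q≤1+c zero r s eq = record
  { α = 0 ; β = 0 ; r₀ = r ; s₀ = s ; α+β≡N = refl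
  ; r≡ = sym (+-identityʳ r) ; s≡ = sym (+-identityʳ s) ; r₀+s₀≡c = trans eq (+-identityʳ c) }
split q c q≤1+c (suc N) r s eq with q ≤? r
... | yes q≤r = addα (split q c q≤1+c N (r ∸ q) s (drop-from-r c N q≤r eq))
  where
  addα : Split q c N (r ∸ q) s → Split q c (suc N) r s
  addα sp = record
    { α = suc α ; β = β ; r₀ = r₀ ; s₀ = s₀ ; α+β≡N = cong suc α+β≡N
    ; r≡ = trans (sym (m+[n∸m]≡n q≤r)) (trans (cong (q +_) r≡) (x+[y+z]≡y+[x+z] q r₀ (α * q)))
    ; s≡ = s≡ ; r₀+s₀≡c = r₀+s₀≡c }
    where open Split sp
... | no q≰r = addβ (split q c q≤1+c N r (s ∸ q) (drop-from-s c N q≤s eq))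
  where
  q≤s : q ≤ s
  q≤s = room-in-s c N q≤1+c (≰⇒> q≰r) eq
  addβ : Split q c N r (s ∸ q) → Split q c (suc N) r s
  addβ sp = record
    { α = α ; β = suc β ; r₀ = r₀ ; s₀ = s₀ ; α+β≡N = trans (+-suc α β) (cong suc α+β≡N) ; r≡ = r≡
    ; s≡ = trans (sym (m+[n∸m]≡n q≤s)) (trans (cong (q +_) s≡) (x+[y+z]≡y+[x+z] q s₀ (β * q)))
    ; r₀+s₀≡c = r₀+s₀≡c }
    where open Split sp

Maybe↔suc : ∀ {n} → Maybe (Fin n) ↔ Fin (suc n)
Maybe↔suc = mk↔ₛ′ (λ { nothing → fzero ; (just i) → fsuc i }) (λ { fzero → nothing ; (fsuc i) → just i })
                  (λ { fzero → refl ; (fsuc i) → refl }) (λ { nothing → refl ; (just i) → refl })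

HWP*-empty : ∀ {m r n s} → r + s ≡ 0 → HWP* 0 m r n s
HWP*-empty {r = zero} {s = zero} refl = (λ ()) , (λ ()) , ((λ ()) , (λ ())) , (λ ())

HWP*-cong : ∀ {v v′ m r r′ n s s′} → v ≡ v′ → r ≡ r′ → s ≡ s′ → HWP* v m r n s → HWP* v′ m r′ n s′
HWP*-cong refl refl refl H = H

HWP*-blowUp : ∀ y {h q μ ν} → h ≡ q * 2 → μ ∣ q → ν ∣ q →
         ((r′ s′ : ℕ) → r′ + s′ ≡ h ∸ 1 → HWP* h (μ * 2) r′ (ν * 2) s′) →
         (r s : ℕ) → r + s ≡ h * suc y ∸ 1 → HWP* (h * suc y) (μ * 2) r (ν * 2) s
HWP*-blowUp y {q = zero} refl _ _ _ r s eq = HWP*-empty eq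
HWP*-blowUp y {q = q@(suc q′)} {μ} {ν} refl (divides u q≡uμ) (divides u′ q≡u′ν) hyp r s eq =
  HWP*-cong vertices (sym r≡) (sym s≡) (decomposition⇒HWP*
    (mapDecomposition vertexIso (blocks r₀ α) (blocks s₀ β)
      (decomposition {μ = μ} {ν} α+β≡N (Q.mk-order {μ} {u} q≡uμ) (Q.mk-order {ν} {u′} q≡u′ν)
        (mapDecomposition halves ↔-refl ↔-refl (HWP*⇒decomposition (hyp r₀ s₀ r₀+s₀≡c))))))
  where
  open Construction y q
  count : r + s ≡ (q * 2 ∸ 1) + (y + y) * q
  count = trans eq (rearrange q′ y)
    where
    rearrange : ∀ q′ y → y + suc (q′ * 2) * suc y ≡ suc (q′ * 2) + (y + y) * suc q′
    rearrange = solve-∀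
  open Split (split q (q * 2 ∸ 1) (s≤s (m≤n⇒m≤1+n (m≤m*n q′ 2))) (y + y) r s count)
  vertices : q * suc (suc (y + y)) ≡ q * 2 * suc y
  vertices = regroup q y
    where
    regroup : ∀ q y → q * suc (suc (y + y)) ≡ q * 2 * suc y
    regroup = solve-∀
  halves : Fin (q * 2) ↔ (Fin q × Bool)
  halves = ↔-trans *↔× (↔-refl ×-↔ 2↔Bool)
  vertexIso : Vertex ↔ Fin (q * suc (suc (y + y)))
  vertexIso = ↔-sym (↔-trans *↔× (↔-refl ×-↔ ↔-sym Maybe↔suc))
  blocks : ∀ t a → (Fin t ⊎ (Fin a × Fin q)) ↔ Fin (t + a * q)
  blocks t a = ↔-sym (↔-trans +↔⊎ (↔-refl ⊎-↔ *↔×))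

halve-common-multiple : ∀ {μ ν h} → μ * 2 ∣ h → ν * 2 ∣ h → ∃ λ q → h ≡ q * 2 × μ ∣ q × ν ∣ q
halve-common-multiple {μ} {ν} {h} (divides t h≡t[μ2]) ν2∣h =
  t * μ , h≡[tμ]2 , divides t refl , *-cancelʳ-∣ 2 (subst (ν * 2 ∣_) h≡[tμ]2 ν2∣h)
  where
  h≡[tμ]2 : h ≡ t * μ * 2
  h≡[tμ]2 = trans h≡t[μ2] (sym (*-assoc t μ 2))

lemma3p2 : (m n : ℕ) → 4 ≤ m → 4 ≤ n → 2 ∣ m → 2 ∣ n →
    ((r′ s′ : ℕ) → r′ + s′ ≡ lcm m n ∸ 1 → HWP* (lcm m n) m r′ n s′) →
    (r s x : ℕ) → r + s ≡ lcm m n * x ∸ 1 → HWP* (lcm m n * x) m r n s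
lemma3p2 m n _ _ _ _ hyp r s zero eq =
  HWP*-cong (sym (*-zeroʳ (lcm m n))) refl refl (HWP*-empty (trans eq (cong (_∸ 1) (*-zeroʳ (lcm m n)))))
lemma3p2 m n _ _ (divides μ refl) (divides ν refl) hyp r s (suc y) eq =
  let q , h≡q*2 , μ∣q , ν∣q = halve-common-multiple {μ} {ν} (m∣lcm[m,n] m n) (n∣lcm[m,n] m n)
  in  HWP*-blowUp y {μ = μ} {ν} h≡q*2 μ∣q ν∣q hyp r s eq
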